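{- For all integers $m,n\ge0$ we have $\alpha_m\Rightarrow\alpha_n$.
   Context: Finite digraphs $D=(V,E)$; $x\to y$ means $(x,y)\in E$; homomorphism: vertex map with $x\to y\Rightarrow f(x)\to f(y)$; $D[W]$ induced subdigraph. For digraphs $D_1,D_2$, $D_1\Rightarrow D_2$ means: every homomorphism $f:D_1[U]\to D_2[W]$ with $\emptyset\ne U\subseteq V(D_1)$, $\emptyset\ne W\subseteq V(D_2)$ extends to a homomorphism $D_1\to D_2$. Construction: for a reflexive tournament $B$, $T(B)$ has vertex set $B\cup B'$ ($B'=\{b':b\in B\}$ disjoint copy), loops at all vertices, $b\to b'$ and $b'\to b$ for each $b\in B$, and for every edge $a\to b$ of $B$ with $a\ne b$ the edges $a\to b$, $b\to a'$, $a'\to b'$, $b'\to a$ (no others). $\alpha_0$ is the one-vertex digraph with a loop; for $n\ge1$, $\alpha_n=T(B)$ with $B$ the transitive reflexive tournament on $n$ vertices (the acyclic tournament with involution on $2n$ vertices). -}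

module Defs where

open import Data.Nat using (ℕ; zero; suc; _+_)
open import Data.Fin using (Fin; splitAt) renaming (_≤_ to _≤ᶠ_)
open import Data.Fin.Subset using (Subset; _∈_; Nonempty)
open import Data.Sum using (_⊎_; inj₁; inj₂)
open import Data.Product using (Σ; Σ-syntax; ∃; _×_; _,_; proj₁)
open import Relation.Binary.PropositionalEquality using (_≡_; _≢_)

record Digraph : Set₁ where
  field
    size : ℕ
    Edge : Fin (size) → Fin (size) → Set
open Digraph public

Vert : (D : Digraph) → Subset (size D) → Set
Vert D U = Σ[ x ∈ Fin (size D) ] x ∈ U

IsPartialHom : (D₁ D₂ : Digraph) (U : Subset (size D₁)) (W : Subset (size D₂)) →
               (Vert D₁ U → Vert D₂ W) → Set
IsPartialHom D₁ D₂ U W f =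
  ∀ (x y : Vert D₁ U) → Edge D₁ (proj₁ x) (proj₁ y) →
    Edge D₂ (proj₁ (f x)) (proj₁ (f y))

IsHom : (D₁ D₂ : Digraph) → (Fin (size D₁) → Fin (size D₂)) → Set
IsHom D₁ D₂ g = ∀ x y → Edge D₁ x y → Edge D₂ (g x) (g y)

_⇛_ : Digraph → Digraph → Set
D₁ ⇛ D₂ =
  (U : Subset (size D₁)) (W : Subset (size D₂)) →
  Nonempty U → Nonempty W →
  (f : Vert D₁ U → Vert D₂ W) → IsPartialHom D₁ D₂ U W f →
  Σ[ g ∈ (Fin (size D₁) → Fin (size D₂)) ]
    (IsHom D₁ D₂ g × (∀ (x : Vert D₁ U) → g (proj₁ x) ≡ proj₁ (f x)))

-- Edges of T(B) on B ⊎ B' (inj₁ b = b, inj₂ b = b'), given B's edge relation E on Fin k.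
data TEdge {k : ℕ} (E : Fin k → Fin k → Set) : Fin k ⊎ Fin k → Fin k ⊎ Fin k → Set where
  loop   : ∀ x → TEdge E x x
  b→b'   : ∀ b → TEdge E (inj₁ b) (inj₂ b)
  b'→b   : ∀ b → TEdge E (inj₂ b) (inj₁ b)
  a→b    : ∀ a b → E a b → a ≢ b → TEdge E (inj₁ a) (inj₁ b)
  b→a'   : ∀ a b → E a b → a ≢ b → TEdge E (inj₁ b) (inj₂ a)
  a'→b'  : ∀ a b → E a b → a ≢ b → TEdge E (inj₂ a) (inj₂ b)
  b'→a   : ∀ a b → E a b → a ≢ b → TEdge E (inj₂ b) (inj₁ a)

-- T(B) for a digraph B (used with B a reflexive tournament); vertices: Fin (k + k),
-- the first k are B, the last k are B'.
T : Digraph → Digraph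
T B = record
  { size = size B + size B
  ; Edge = λ x y → TEdge (Edge B) (splitAt (size B) x) (splitAt (size B) y)
  }

TT : ℕ → Digraph
TT n = record { size = n ; Edge = _≤ᶠ_ }

α₀ : Digraph
α₀ = record { size = 1 ; Edge = λ _ _ → _≡_ {A = ℕ} 0 0 }

α : ℕ → Digraph
α zero    = α₀
α (suc n) = T (TT (suc n))

-- Write (i , false) for the vertex i of the transitive tournament and (i , true) for i′.  Then arcs
-- between distinct indices go up on the same side and down across the sides, so the arc relation
-- is invariant under the rotation (p , q) ↦ (q , flip p), where flip changes the side.  Hence a
-- partial homomorphism f defined on U extends to the flip-closure of U by f (flip p) := flip (f p).
-- The flip-closure is I × Bool for the set I of indices met by U, and α is retracted onto I × Bool
-- by sending (i , s) to (j , s) for the greatest j ∈ I below i, and to (max I , not s) when there is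
-- no such j.  Composing the two gives the required extension.
module Submission where

open import Defs
open import Data.Bool using (Bool; true; false; not)
open import Data.Bool.Properties using (not-involutive)
open import Data.Empty using (⊥-elim)
open import Data.Fin as Fin using (Fin; splitAt; join; fromℕ; _<_) renaming (_≤_ to _≤ᶠ_)
open import Data.Fin.Properties
  using (_≟_; ≤-refl; ≤-trans; ≤-antisym; <⇒≢; ≤∧≢⇒<; ≤fromℕ; splitAt-join; join-splitAt)
open import Data.Fin.Subset using (_∈_)
open import Data.Fin.Subset.Properties using (_∈?_)
open import Data.Nat using (ℕ; zero; suc; _+_; z≤n; s≤s)
open import Data.Nat.Properties using (<⇒≤)
open import Data.Product using (Σ; Σ-syntax; ∃; _×_; _,_; proj₁; proj₂)
open import Data.Sum using (_⊎_; inj₁; inj₂)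
open import Data.Vec.Properties.WithK using ([]=-irrelevant)
open import Function using (_∘_)
open import Relation.Nullary using (¬_; yes; no)
open import Relation.Nullary.Decidable using (_⊎-dec_)
open import Relation.Unary using (Decidable; Irrelevant)
open import Relation.Binary.PropositionalEquality
  using (_≡_; refl; sym; trans; cong; subst; subst₂; module ≡-Reasoning)

Fin1-unique : (x y : Fin 1) → x ≡ y
Fin1-unique Fin.zero Fin.zero = refl

Vert-≡ : ∀ {D U} {x y : Fin (size D)} → x ≡ y → (u : x ∈ U) (v : y ∈ U) →
         _≡_ {A = Vert D U} (x , u) (y , v)
Vert-≡ refl u v = cong (_ ,_) ([]=-irrelevant u v)

α-reflexive : ∀ n (x : Fin (size (α n))) → Edge (α n) x x
α-reflexive zero    x = refl
α-reflexive (suc n) x = loop _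

⇛α₀ : ∀ D → D ⇛ α₀
⇛α₀ D _ _ _ _ f _ = (λ _ → Fin.zero) , (λ _ _ _ → refl) , λ x → Fin1-unique _ _

α₀⇛ : ∀ D → (∀ x → Edge D x x) → α₀ ⇛ D
α₀⇛ D D-refl _ _ (x , x∈U) _ f _ =
  (λ _ → proj₁ (f (x , x∈U))) , (λ _ _ _ → D-refl _) ,
  λ { (y , y∈U) → cong (proj₁ ∘ f) (Vert-≡ {α₀} (Fin1-unique x y) x∈U y∈U) }

Point : ℕ → Set
Point n = Fin n × Bool

flip : ∀ {n} → Point n → Point n
flip (i , s) = i , not s

flip-involutive : ∀ {n} (p : Point n) → flip (flip p) ≡ p
flip-involutive (i , s) = cong (i ,_) (not-involutive s)

infix 4 _⇝_

data _⇝_ {n} : Point n → Point n → Set where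
  same : ∀ {i s t} → (i , s) ⇝ (i , t)
  up   : ∀ {i j s} → i < j → (i , s) ⇝ (j , s)
  down : ∀ {i j s} → j < i → (i , s) ⇝ (j , not s)

module _ {n : ℕ} where

  ⇝-rotate : {p q : Point n} → p ⇝ q → q ⇝ flip p
  ⇝-rotate same       = same
  ⇝-rotate (up i<j)   = down i<j
  ⇝-rotate (down j<i) = up j<i

  ⇝-flip : {p q : Point n} → p ⇝ q → flip p ⇝ flip q
  ⇝-flip = ⇝-rotate ∘ ⇝-rotate

  ⇝-unrotate : {p q : Point n} → p ⇝ q → flip q ⇝ p
  ⇝-unrotate {p} p⇝q = subst (_ ⇝_) (flip-involutive p) (⇝-rotate (⇝-flip p⇝q))

  ≡⇒⇝ : ∀ {i j : Fin n} {s t} → i ≡ j → (i , s) ⇝ (j , t)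
  ≡⇒⇝ refl = same

  ≤⇒⇝ : ∀ {i j : Fin n} {s} → i ≤ᶠ j → (i , s) ⇝ (j , s)
  ≤⇒⇝ {i} {j} i≤j with i ≟ j
  ... | yes i≡j = ≡⇒⇝ i≡j
  ... | no  i≢j  = up (≤∧≢⇒< i≤j i≢j)

toPoint : ∀ {n} → Fin n ⊎ Fin n → Point n
toPoint (inj₁ i) = i , false
toPoint (inj₂ i) = i , true

fromPoint : ∀ {n} → Point n → Fin n ⊎ Fin n
fromPoint (i , false) = inj₁ i
fromPoint (i , true)  = inj₂ i

fromPoint-toPoint : ∀ {n} (x : Fin n ⊎ Fin n) → fromPoint (toPoint x) ≡ x
fromPoint-toPoint (inj₁ _) = refl
fromPoint-toPoint (inj₂ _) = refl

TEdge⇒⇝ : ∀ {n} {x y : Fin n ⊎ Fin n} → TEdge _≤ᶠ_ x y → toPoint x ⇝ toPoint y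
TEdge⇒⇝ (loop (inj₁ _))     = same
TEdge⇒⇝ (loop (inj₂ _))     = same
TEdge⇒⇝ (b→b' _)            = same
TEdge⇒⇝ (b'→b _)            = same
TEdge⇒⇝ (a→b _ _ a≤b a≢b)   = up   (≤∧≢⇒< a≤b a≢b)
TEdge⇒⇝ (b→a' _ _ a≤b a≢b)  = down (≤∧≢⇒< a≤b a≢b)
TEdge⇒⇝ (a'→b' _ _ a≤b a≢b) = up   (≤∧≢⇒< a≤b a≢b)
TEdge⇒⇝ (b'→a _ _ a≤b a≢b)  = down (≤∧≢⇒< a≤b a≢b)

⇝⇒TEdge : ∀ {n} (x y : Fin n ⊎ Fin n) → toPoint x ⇝ toPoint y → TEdge _≤ᶠ_ x y
⇝⇒TEdge (inj₁ _) (inj₁ _) same       = loop _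
⇝⇒TEdge (inj₁ i) (inj₂ _) same       = b→b' i
⇝⇒TEdge (inj₂ i) (inj₁ _) same       = b'→b i
⇝⇒TEdge (inj₂ _) (inj₂ _) same       = loop _
⇝⇒TEdge (inj₁ i) (inj₁ j) (up i<j)   = a→b i j (<⇒≤ i<j) (<⇒≢ i<j)
⇝⇒TEdge (inj₂ i) (inj₂ j) (up i<j)   = a'→b' i j (<⇒≤ i<j) (<⇒≢ i<j)
⇝⇒TEdge (inj₁ i) (inj₂ j) (down j<i) = b→a' j i (<⇒≤ j<i) (<⇒≢ j<i)
⇝⇒TEdge (inj₂ i) (inj₁ j) (down j<i) = b'→a j i (<⇒≤ j<i) (<⇒≢ j<i)

record GreatestBelow {n} (Q : Fin n → Set) (i : Fin n) : Set where
  field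
    index   : Fin n
    index≤  : index ≤ᶠ i
    holds   : Q index
    maximal : ∀ {k} → k ≤ᶠ i → Q k → k ≤ᶠ index

NoneBelow : ∀ {n} → (Fin n → Set) → Fin n → Set
NoneBelow Q i = ∀ {k} → k ≤ᶠ i → ¬ Q k

greatestBelow? : ∀ {n} {Q : Fin n → Set} → Decidable Q →
                 (i : Fin n) → GreatestBelow Q i ⊎ NoneBelow Q i
greatestBelow? Q? Fin.zero with Q? Fin.zero
... | yes q = inj₁ (record
  { index   = Fin.zero
  ; index≤  = z≤n
  ; holds   = q
  ; maximal = λ k≤0 _ → k≤0
  })
... | no ¬q = inj₂ λ { {Fin.zero} _ → ¬q ; {Fin.suc _} () }
greatestBelow? Q? (Fin.suc i) with greatestBelow? (Q? ∘ Fin.suc) i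
... | inj₁ g = inj₁ (record
  { index   = Fin.suc index
  ; index≤  = s≤s index≤
  ; holds   = holds
  ; maximal = λ { {Fin.zero} _ _ → z≤n ; {Fin.suc _} (s≤s k≤i) q → s≤s (maximal k≤i q) }
  })
  where open GreatestBelow g
... | inj₂ none with Q? Fin.zero
...   | yes q = inj₁ (record
  { index   = Fin.zero
  ; index≤  = z≤n
  ; holds   = q
  ; maximal = λ { {Fin.zero} _ _ → z≤n ; {Fin.suc _} (s≤s k≤i) q → ⊥-elim (none k≤i q) }
  })
...   | no ¬q = inj₂ λ { {Fin.zero} _ → ¬q ; {Fin.suc _} (s≤s k≤i) → none k≤i }

maximum : ∀ {n} {Q : Fin n → Set} → Decidable Q → ∃ Q →
          Σ[ M ∈ Fin n ] (Q M × (∀ {k} → Q k → k ≤ᶠ M))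
maximum {zero}  _  (() , _)
maximum {suc n} Q? (i , q) with greatestBelow? Q? (fromℕ n)
... | inj₁ g    = index , holds , maximal (≤fromℕ _)
  where open GreatestBelow g
... | inj₂ none = ⊥-elim (none (≤fromℕ i) q)

module Retraction {n} {I : Fin n → Set} (I? : Decidable I) (I-nonempty : ∃ I) where

  open GreatestBelow

  Retract : Set
  Retract = Σ (Point n) (I ∘ proj₁)

  M : Fin n
  M = proj₁ (maximum I? I-nonempty)

  I-M : I M
  I-M = proj₁ (proj₂ (maximum I? I-nonempty))

  ≤M : ∀ {k} → I k → k ≤ᶠ M
  ≤M = proj₂ (proj₂ (maximum I? I-nonempty))

  -- Wrapping around from below min I to max I crosses a down arc, hence the change of side.
  retractAt : ∀ i → GreatestBelow I i ⊎ NoneBelow I i → Bool → Retract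
  retractAt _ (inj₁ g) s = (index g , s) , holds g
  retractAt _ (inj₂ _) s = (M , not s) , I-M

  retract : Point n → Retract
  retract (i , s) = retractAt i (greatestBelow? I? i) s

  retractAt-⇝ : ∀ {i j s t} r r′ → (i , s) ⇝ (j , t) →
                proj₁ (retractAt i r s) ⇝ proj₁ (retractAt j r′ t)
  retractAt-⇝ (inj₁ g) (inj₁ g′) same =
    ≡⇒⇝ (≤-antisym (maximal g′ (index≤ g) (holds g)) (maximal g (index≤ g′) (holds g′)))
  retractAt-⇝ (inj₁ g) (inj₂ none′) same = ⊥-elim (none′ (index≤ g) (holds g))
  retractAt-⇝ (inj₂ none) (inj₁ g′) same = ⊥-elim (none (index≤ g′) (holds g′))
  retractAt-⇝ (inj₂ _) (inj₂ _) same = same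
  retractAt-⇝ (inj₁ g) (inj₁ g′) (up i<j) =
    ≤⇒⇝ (maximal g′ (≤-trans (index≤ g) (<⇒≤ i<j)) (holds g))
  retractAt-⇝ (inj₁ g) (inj₂ none′) (up i<j) =
    ⊥-elim (none′ (≤-trans (index≤ g) (<⇒≤ i<j)) (holds g))
  retractAt-⇝ (inj₂ _) (inj₁ g′) (up _) = ⇝-unrotate (≤⇒⇝ (≤M (holds g′)))
  retractAt-⇝ (inj₂ _) (inj₂ _) (up _) = same
  retractAt-⇝ (inj₁ g) (inj₁ g′) (down j<i) =
    ⇝-rotate (≤⇒⇝ (maximal g (≤-trans (index≤ g′) (<⇒≤ j<i)) (holds g′)))
  retractAt-⇝ (inj₁ g) (inj₂ _) (down _) = ⇝-rotate (⇝-unrotate (≤⇒⇝ (≤M (holds g))))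
  retractAt-⇝ (inj₂ none) (inj₁ g′) (down j<i) =
    ⊥-elim (none (≤-trans (index≤ g′) (<⇒≤ j<i)) (holds g′))
  retractAt-⇝ (inj₂ _) (inj₂ _) (down _) = same

  retract-⇝ : ∀ {p q} → p ⇝ q → proj₁ (retract p) ⇝ proj₁ (retract q)
  retract-⇝ {i , _} {j , _} = retractAt-⇝ (greatestBelow? I? i) (greatestBelow? I? j)

  retract-fixes : ∀ {p} → I (proj₁ p) → proj₁ (retract p) ≡ p
  retract-fixes {i , s} Ii with greatestBelow? I? i
  ... | inj₁ g    = cong (_, s) (≤-antisym (index≤ g) (maximal g ≤-refl Ii))
  ... | inj₂ none = ⊥-elim (none ≤-refl Ii)

module FlipClosure {N K} {U : Point N → Set} (U? : Decidable U) (U-irrelevant : Irrelevant U)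
  (f : ∀ p → U p → Point K) (f-⇝ : ∀ {p q} u v → p ⇝ q → f p u ⇝ f q v) where

  Closure : Point N → Set
  Closure p = U p ⊎ U (flip p)

  f̂ : ∀ p → Closure p → Point K
  f̂ p (inj₁ u) = f p u
  f̂ p (inj₂ u) = flip (f (flip p) u)

  f̂-⇝ : ∀ {p q} c d → p ⇝ q → f̂ p c ⇝ f̂ q d
  f̂-⇝ (inj₁ u) (inj₁ v) p⇝q = f-⇝ u v p⇝q
  f̂-⇝ (inj₁ u) (inj₂ v) p⇝q = ⇝-rotate (f-⇝ v u (⇝-unrotate p⇝q))
  f̂-⇝ (inj₂ u) (inj₁ v) p⇝q = ⇝-unrotate (f-⇝ v u (⇝-rotate p⇝q))
  f̂-⇝ (inj₂ u) (inj₂ v) p⇝q = ⇝-flip (f-⇝ u v (⇝-flip p⇝q))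

  Occupied : Fin N → Set
  Occupied i = U (i , false) ⊎ U (i , true)

  Occupied? : Decidable Occupied
  Occupied? i = U? (i , false) ⊎-dec U? (i , true)

  occupied : ∀ {i} s → U (i , s) → Occupied i
  occupied false = inj₁
  occupied true  = inj₂

  otherSide : ∀ {i} s → Occupied i → ¬ U (i , s) → U (i , not s)
  otherSide false (inj₁ u) ¬u = ⊥-elim (¬u u)
  otherSide false (inj₂ u) _  = u
  otherSide true  (inj₁ u) _  = u
  otherSide true  (inj₂ u) ¬u = ⊥-elim (¬u u)

  -- U itself must be preferred: f̂ p (inj₂ _) need not agree with f on U.
  inClosure : ∀ {i} s → Occupied i → Closure (i , s)
  inClosure {i} s o with U? (i , s)
  ... | yes u = inj₁ u
  ... | no ¬u = inj₂ (otherSide s o ¬u)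

  f̂-inClosure : ∀ {i s} (o : Occupied i) (u : U (i , s)) →
                f̂ (i , s) (inClosure s o) ≡ f (i , s) u
  f̂-inClosure {i} {s} o u with U? (i , s)
  ... | yes u′ = cong (f (i , s)) (U-irrelevant u′ u)
  ... | no ¬u  = ⊥-elim (¬u u)

  extendOccupied : Σ (Point N) (Occupied ∘ proj₁) → Point K
  extendOccupied ((i , s) , o) = f̂ (i , s) (inClosure s o)

  extendOccupied-⇝ : ∀ {x y} → proj₁ x ⇝ proj₁ y → extendOccupied x ⇝ extendOccupied y
  extendOccupied-⇝ {(_ , s) , o} {(_ , t) , o′} = f̂-⇝ (inClosure s o) (inClosure t o′)

  extendOccupied-extends : ∀ x {p} → proj₁ x ≡ p → (u : U p) → extendOccupied x ≡ f p u
  extendOccupied-extends (_ , o) refl = f̂-inClosure o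

HomExtension : ∀ {N K} {U : Point N → Set} → (∀ p → U p → Point K) → Set
HomExtension {N} {K} f =
  Σ[ g ∈ (Point N → Point K) ] ((∀ {p q} → p ⇝ q → g p ⇝ g q) × (∀ p u → g p ≡ f p u))

extend-⇝ : ∀ {N K} {U : Point N → Set} → Decidable U → Irrelevant U → ∃ U →
           (f : ∀ p → U p → Point K) → (∀ {p q} u v → p ⇝ q → f p u ⇝ f q v) →
           HomExtension f
extend-⇝ U? U-irrelevant ((i , s) , u) f f-⇝ =
  extendOccupied ∘ retract ,
  extendOccupied-⇝ ∘ retract-⇝ ,
  λ p u → extendOccupied-extends (retract p) (retract-fixes (occupied _ u)) u
  where
  open FlipClosure U? U-irrelevant f f-⇝
  open Retraction Occupied? (i , occupied s u)

vertex : ∀ N → Fin (N + N) → Point N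
vertex N = toPoint ∘ splitAt N

unvertex : ∀ N → Point N → Fin (N + N)
unvertex N = join N N ∘ fromPoint

vertex-unvertex : ∀ N p → vertex N (unvertex N p) ≡ p
vertex-unvertex N (i , false) = cong toPoint (splitAt-join N N (inj₁ i))
vertex-unvertex N (i , true)  = cong toPoint (splitAt-join N N (inj₂ i))

unvertex-vertex : ∀ N x → unvertex N (vertex N x) ≡ x
unvertex-vertex N x =
  trans (cong (join N N) (fromPoint-toPoint (splitAt N x))) (join-splitAt N N x)

edge⇒⇝ : ∀ {N x y} → Edge (T (TT N)) x y → vertex N x ⇝ vertex N y
edge⇒⇝ = TEdge⇒⇝

⇝⇒edge : ∀ {N p q} → p ⇝ q → Edge (T (TT N)) (unvertex N p) (unvertex N q)
⇝⇒edge {N} {p} {q} p⇝q =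
  ⇝⇒TEdge _ _ (subst₂ _⇝_ (sym (vertex-unvertex N p)) (sym (vertex-unvertex N q)) p⇝q)

T-TT⇛T-TT : ∀ m n → T (TT m) ⇛ T (TT n)
T-TT⇛T-TT m n U _ (x , x∈U) _ f f-hom = g , g-hom , g-extends
  where
  open ≡-Reasoning

  U′ : Point m → Set
  U′ p = unvertex m p ∈ U

  f′ : ∀ p → U′ p → Point n
  f′ p u = vertex n (proj₁ (f (unvertex m p , u)))

  extension : HomExtension f′
  extension = extend-⇝ (λ p → unvertex m p ∈? U) []=-irrelevant
                (vertex m x , subst (_∈ U) (sym (unvertex-vertex m x)) x∈U)
                f′ (λ u v p⇝q → edge⇒⇝ (f-hom _ _ (⇝⇒edge p⇝q)))

  G : Point m → Point n
  G = proj₁ extension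

  g : Fin (m + m) → Fin (n + n)
  g = unvertex n ∘ G ∘ vertex m

  g-hom : IsHom (T (TT m)) (T (TT n)) g
  g-hom _ _ e = ⇝⇒edge (proj₁ (proj₂ extension) (edge⇒⇝ e))

  g-extends : ∀ (y : Vert (T (TT m)) U) → g (proj₁ y) ≡ proj₁ (f y)
  g-extends (y , y∈U) = begin
    unvertex n (G (vertex m y))
      ≡⟨ cong (unvertex n) (proj₂ (proj₂ extension) (vertex m y) u) ⟩
    unvertex n (vertex n (proj₁ (f (unvertex m (vertex m y) , u))))
      ≡⟨ unvertex-vertex n _ ⟩
    proj₁ (f (unvertex m (vertex m y) , u))
      ≡⟨ cong (proj₁ ∘ f) (Vert-≡ {T (TT m)} (unvertex-vertex m y) u y∈U) ⟩
    proj₁ (f (y , y∈U))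
      ∎
    where
    u : U′ (vertex m y)
    u = subst (_∈ U) (sym (unvertex-vertex m y)) y∈U

lemma4p7 : (m n : ℕ) → α m ⇛ α n
lemma4p7 zero    n       = α₀⇛ (α n) (α-reflexive n)
lemma4p7 (suc m) zero    = ⇛α₀ (α (suc m))
lemma4p7 (suc m) (suc n) = T-TT⇛T-TT (suc m) (suc n)
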